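{- Let $n$ be an integer with $8\le n\equiv0\pmod4$ and let $F_1,F_2$ be binary frequency squares of order $n$ (not necessarily orthogonal). Let $r,r'$ be two distinct rows. If there exist two distinct columns $c,c'$ such that $(F_1[r,c],F_2[r,c])=(F_1[r',c],F_2[r',c])$ and $(F_1[r,c'],F_2[r,c'])=(F_1[r',c'],F_2[r',c'])$, then the pair $\{r,r'\}$ is balanceable.
   Context: A binary frequency square of order $n$ is an $n\times n$ $\{0,1\}$-array with $n/2$ zeros and $n/2$ ones in each row and each column. A $2\times n$ binary frequency rectangle is a $2\times n$ $\{0,1\}$-array in which each row has $n/2$ zeros and $n/2$ ones and each column has one $0$ and one $1$. For rows $r_1,r_2$, let $F_i(r_1,r_2)$ denote the $2\times n$ array consisting of rows $r_1,r_2$ of $F_i$. Two binary arrays $L,L'$ of the same dimensions are orthogonal if, superimposed, each of $(0,0),(0,1),(1,0),(1,1)$ occurs equally often. The pair $\{r_1,r_2\}$ is balanceable if there is a $2\times n$ binary frequency rectangle orthogonal to both $F_1(r_1,r_2)$ and $F_2(r_1,r_2)$. -}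

module Defs where

open import Data.Nat using (ℕ; zero; suc; _+_; _*_)
open import Data.Bool using (Bool; true; false; if_then_else_)
open import Data.Fin using (Fin; zero; suc)
open import Data.Product using (_×_; Σ; _,_)
open import Relation.Binary.PropositionalEquality using (_≡_)
open import Relation.Nullary using (¬_)

count : {m : ℕ} → (Fin m → Bool) → ℕ
count {zero}  f = 0
count {suc m} f = (if f zero then 1 else 0) + count (λ i → f (suc i))

eqB : Bool → Bool → Bool
eqB true  true  = true
eqB false false = true
eqB _     _     = false

occ : {m : ℕ} → Bool → (Fin m → Bool) → ℕ
occ b v = count (λ i → eqB (v i) b)

-- A binary array with r rows and c columns: entries in {0,1} = {false,true}
-- (false represents 0, true represents 1).
Array : ℕ → ℕ → Set
Array r c = Fin r → Fin c → Bool

IsBFS : (n h : ℕ) → n ≡ 2 * h → Array n n → Set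
IsBFS n h _ F =
  (∀ i → occ false (λ j → F i j) ≡ h × occ true (λ j → F i j) ≡ h) ×
  (∀ j → occ false (λ i → F i j) ≡ h × occ true (λ i → F i j) ≡ h)

IsBFR : (n h : ℕ) → n ≡ 2 * h → Array 2 n → Set
IsBFR n h _ R =
  (∀ i → occ false (λ j → R i j) ≡ h × occ true (λ j → R i j) ≡ h) ×
  (∀ j → occ false (λ i → R i j) ≡ 1 × occ true (λ i → R i j) ≡ 1)

sumF : {m : ℕ} → (Fin m → ℕ) → ℕ
sumF {zero}  f = 0
sumF {suc m} f = f zero + sumF (λ i → f (suc i))

pairCount : {r c : ℕ} → Array r c → Array r c → Bool → Bool → ℕ
pairCount L L' a b =
  sumF (λ i → count (λ j → if eqB (L i j) a then eqB (L' i j) b else false))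

Orthogonal : {r c : ℕ} → Array r c → Array r c → Set
Orthogonal L L' = ∀ a b a' b' → pairCount L L' a b ≡ pairCount L L' a' b'

rowsOf : {n : ℕ} → Array n n → Fin n → Fin n → Array 2 n
rowsOf F r1 r2 zero    j = F r1 j
rowsOf F r1 r2 (suc _) j = F r2 j

Balanceable : (n h : ℕ) → n ≡ 2 * h → Array n n → Array n n → Fin n → Fin n → Set
Balanceable n h e F1 F2 r1 r2 =
  Σ (Array 2 n) λ R → IsBFR n h e R ×
    Orthogonal R (rowsOf F1 r1 r2) × Orthogonal R (rowsOf F2 r1 r2)

-- For a column j let α j, β j ∈ {+, 0, −} be the signs of F₁[r,j] − F₁[r',j] and F₂[r,j] − F₂[r',j],
-- and let N a b be the number of columns with sign pair (a, b). Rows r and r' of F₁ have equal weight,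
-- so N has as many + as − in its first coordinate; likewise for F₂ and the second coordinate. A
-- rectangle with rows x and ¬x is a frequency rectangle orthogonal to both 2 × n subarrays exactly
-- when x picks n/2 columns whose sign pairs are balanced in the same sense, so it suffices to find a
-- balanced sub-table of N of half its size and then pick columns with these counts. Up to a symmetry
-- of the square {+,0,−}², N splits into zero-sum blocks: pairs {v, −v}, quadruples
-- {(+,+), (+,−), (−,0), (−,0)}, triples {(+,+), (−,0), (0,−)} and single (0,0) columns, at least two
-- of which exist (c and c'). A parity argument on the block sizes, using 4 ∣ n, selects blocks of
-- total size n/2.

module Submission where

open import Defs
open import Data.Nat using (ℕ; _≤_; _*_)
open import Data.Fin using (Fin)
open import Data.Product using (_×_)
open import Relation.Binary.PropositionalEquality using (_≡_; _≢_)

open import Data.Bool using (Bool; true; false; if_then_else_; _∧_; _∨_; not)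
open import Data.Bool.Properties using (∧-assoc; ∧-comm; ∧-conicalˡ; ∧-conicalʳ)
open import Data.Fin using (zero; suc)
open import Data.Nat using (zero; suc; _+_; _∸_; _⊓_; pred; _<ᵇ_; z≤n; s≤s; _≤?_)
open import Data.Nat.Properties
open import Data.Nat.Tactic.RingSolver using (solve-∀)
open import Data.Product using (∃-syntax; _,_; proj₁; proj₂; uncurry)
open import Function using (_∘_; _⇔_; mk⇔; Equivalence)
open import Relation.Nullary using (yes; no; contradiction)
open import Relation.Binary.PropositionalEquality
  using (refl; sym; trans; cong; cong₂; subst; ≢-sym; module ≡-Reasoning)

indicator : Bool → ℕ
indicator b = if b then 1 else 0

count≡sumF : ∀ {m} (f : Fin m → Bool) → count f ≡ sumF (indicator ∘ f)
count≡sumF {zero}  f = refl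
count≡sumF {suc m} f = cong (indicator (f zero) +_) (count≡sumF (f ∘ suc))

sumF-cong : ∀ {m} {f g : Fin m → ℕ} → (∀ j → f j ≡ g j) → sumF f ≡ sumF g
sumF-cong {zero}  f≗g = refl
sumF-cong {suc m} f≗g = cong₂ _+_ (f≗g zero) (sumF-cong (f≗g ∘ suc))

sumF-+ : ∀ {m} (f g : Fin m → ℕ) → sumF (λ j → f j + g j) ≡ sumF f + sumF g
sumF-+ {zero}  f g = refl
sumF-+ {suc m} f g = begin
  f zero + g zero + sumF (λ j → f (suc j) + g (suc j))
    ≡⟨ cong (f zero + g zero +_) (sumF-+ (f ∘ suc) (g ∘ suc)) ⟩
  f zero + g zero + (sumF (f ∘ suc) + sumF (g ∘ suc))
    ≡⟨ +-assoc-comm (f zero) (g zero) (sumF (f ∘ suc)) (sumF (g ∘ suc)) ⟩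
  f zero + sumF (f ∘ suc) + (g zero + sumF (g ∘ suc)) ∎
  where
  open ≡-Reasoning
  +-assoc-comm : ∀ a b c d → a + b + (c + d) ≡ a + c + (b + d)
  +-assoc-comm = solve-∀

count-cong : ∀ {m} {f g : Fin m → Bool} → (∀ j → f j ≡ g j) → count f ≡ count g
count-cong {f = f} {g} f≗g = begin
  count f                 ≡⟨ count≡sumF f ⟩
  sumF (indicator ∘ f)    ≡⟨ sumF-cong (cong indicator ∘ f≗g) ⟩
  sumF (indicator ∘ g)    ≡⟨ count≡sumF g ⟨
  count g                 ∎
  where open ≡-Reasoning

count-+ : ∀ {m} (f g h : Fin m → Bool) →
  (∀ j → indicator (f j) + indicator (g j) ≡ indicator (h j)) → count f + count g ≡ count h
count-+ f g h split = begin
  count f + count g                                   ≡⟨ cong₂ _+_ (count≡sumF f) (count≡sumF g) ⟩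
  sumF (indicator ∘ f) + sumF (indicator ∘ g)          ≡⟨ sumF-+ (indicator ∘ f) (indicator ∘ g) ⟨
  sumF (λ j → indicator (f j) + indicator (g j))      ≡⟨ sumF-cong split ⟩
  sumF (indicator ∘ h)                                 ≡⟨ count≡sumF h ⟨
  count h                                              ∎
  where open ≡-Reasoning

count-true : ∀ m → count {m} (λ _ → true) ≡ m
count-true zero    = refl
count-true (suc m) = cong suc (count-true m)

1≤count : ∀ {m} (f : Fin m → Bool) {c} → f c ≡ true → 1 ≤ count f
1≤count f {zero}  fc with f zero
... | true = s≤s z≤n
1≤count f {suc c} fc with f zero
... | true  = s≤s z≤n
... | false = 1≤count (f ∘ suc) fc

2≤count : ∀ {m} (f : Fin m → Bool) {c c'} → c ≢ c' → f c ≡ true → f c' ≡ true → 2 ≤ count f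
2≤count f {zero}  {zero}   c≢c' _ _ = contradiction refl c≢c'
2≤count f {zero}  {suc c'} _ fc fc' with f zero
... | true = s≤s (1≤count (f ∘ suc) fc')
2≤count f {suc c} {zero}   _ fc fc' with f zero
... | true = s≤s (1≤count (f ∘ suc) fc)
2≤count f {suc c} {suc c'} c≢c' fc fc' with f zero
... | true  = m≤n⇒m≤1+n (2≤count (f ∘ suc) (c≢c' ∘ cong suc) fc fc')
... | false = 2≤count (f ∘ suc) (c≢c' ∘ cong suc) fc fc'

occ-true : ∀ {m} (x : Fin m → Bool) → occ true x ≡ count x
occ-true x = count-cong (λ j → eqB-true (x j))
  where
  eqB-true : ∀ b → eqB b true ≡ b
  eqB-true true  = refl
  eqB-true false = refl

occ-true+occ-false : ∀ {m} (x : Fin m → Bool) → occ true x + occ false x ≡ m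
occ-true+occ-false {m} x = trans (count-+ _ _ (λ _ → true) (λ j → one (x j))) (count-true m)
  where
  one : ∀ b → indicator (eqB b true) + indicator (eqB b false) ≡ 1
  one true  = refl
  one false = refl

occ-not : ∀ {m} (x : Fin m → Bool) b → occ b (not ∘ x) ≡ occ (not b) x
occ-not x b = count-cong (λ j → eqB-not (x j) b)
  where
  eqB-not : ∀ c b → eqB (not c) b ≡ eqB c (not b)
  eqB-not true  true  = refl
  eqB-not true  false = refl
  eqB-not false true  = refl
  eqB-not false false = refl

occ-both : ∀ {m h} (v : Fin m → Bool) → occ false v ≡ h × occ true v ≡ h → ∀ b → occ b v ≡ h
occ-both _ (f≡h , _) false = f≡h
occ-both _ (_ , t≡h) true  = t≡h

count≡half⇒occ : ∀ {m h} (x : Fin m → Bool) → m ≡ 2 * h → count x ≡ h → ∀ b → occ b x ≡ h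
count≡half⇒occ x m≡2h count≡h true  = trans (occ-true x) count≡h
count≡half⇒occ {h = h} x m≡2h count≡h false =
  trans (+-cancelˡ-≡ h _ _ (trans (cong (_+ occ false x) (sym (count≡half⇒occ x m≡2h count≡h true)))
                                   (trans (occ-true+occ-false x) m≡2h)))
        (+-identityʳ h)

equal-row-weights : ∀ {n h} (F : Array n n) → (∀ i → occ false (F i) ≡ h × occ true (F i) ≡ h) →
  ∀ i i' → count (F i) ≡ count (F i')
equal-row-weights {h = h} F rows i i' =
  trans (weight i) (sym (weight i'))
  where
  weight : ∀ i → count (F i) ≡ h
  weight i = trans (sym (occ-true (F i))) (proj₂ (rows i))

data Sign : Set where
  pos same neg : Sign

opp : Sign → Sign
opp pos  = neg
opp same = same
opp neg  = pos

opp-involutive : ∀ a → opp (opp a) ≡ a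
opp-involutive pos  = refl
opp-involutive same = refl
opp-involutive neg  = refl

_==_ : Sign → Sign → Bool
pos  == pos  = true
same == same = true
neg  == neg  = true
_    == _    = false

==⇒≡ : ∀ a b → a == b ≡ true → a ≡ b
==⇒≡ pos  pos  _ = refl
==⇒≡ same same _ = refl
==⇒≡ neg  neg  _ = refl

sign : Bool → Bool → Sign
sign true  false = pos
sign false true  = neg
sign _     _     = same

signs : ∀ {m} → (Fin m → Bool) → (Fin m → Bool) → Fin m → Sign
signs u u' j = sign (u j) (u' j)

count-by-sign : ∀ {m} (g : Fin m → Bool) (σ : Fin m → Sign) →
  count (λ j → g j ∧ (σ j == pos)) + count (λ j → g j ∧ (σ j == same)) + count (λ j → g j ∧ (σ j == neg))
  ≡ count g
count-by-sign g σ =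
  trans (cong (_+ count (λ j → g j ∧ (σ j == neg))) (count-+ _ _ _ (λ j → split₁ (g j) (σ j))))
        (count-+ _ _ _ (λ j → split₂ (g j) (σ j)))
  where
  split₁ : ∀ b s → indicator (b ∧ (s == pos)) + indicator (b ∧ (s == same)) ≡ indicator (b ∧ not (s == neg))
  split₁ false _    = refl
  split₁ true  pos  = refl
  split₁ true  same = refl
  split₁ true  neg  = refl
  split₂ : ∀ b s → indicator (b ∧ not (s == neg)) + indicator (b ∧ (s == neg)) ≡ indicator b
  split₂ false _    = refl
  split₂ true  pos  = refl
  split₂ true  same = refl
  split₂ true  neg  = refl

count-∧-sign : ∀ {m} (g u v : Fin m → Bool) →
  count (λ j → g j ∧ u j) + count (λ j → g j ∧ (signs u v j == neg))
  ≡ count (λ j → g j ∧ v j) + count (λ j → g j ∧ (signs u v j == pos))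
count-∧-sign g u v =
  trans (count-+ _ _ (λ j → g j ∧ (u j ∨ v j)) (λ j → left (g j) (u j) (v j)))
        (sym (count-+ _ _ _ (λ j → right (g j) (u j) (v j))))
  where
  left : ∀ b x y → indicator (b ∧ x) + indicator (b ∧ (sign x y == neg)) ≡ indicator (b ∧ (x ∨ y))
  left false _     _     = refl
  left true  true  true  = refl
  left true  true  false = refl
  left true  false true  = refl
  left true  false false = refl
  right : ∀ b x y → indicator (b ∧ y) + indicator (b ∧ (sign x y == pos)) ≡ indicator (b ∧ (x ∨ y))
  right false _     _     = refl
  right true  true  true  = refl
  right true  true  false = refl
  right true  false true  = refl
  right true  false false = refl

equal-weights⇔sign-balanced : ∀ {m} (g u u' : Fin m → Bool) →
  count (λ j → g j ∧ u j) ≡ count (λ j → g j ∧ u' j) ⇔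
  count (λ j → g j ∧ (signs u u' j == pos)) ≡ count (λ j → g j ∧ (signs u u' j == neg))
equal-weights⇔sign-balanced g u u' = mk⇔
  (λ eq → sym (+-cancelˡ-≡ (count (λ j → g j ∧ u' j)) _ _ (trans (cong (_+ #neg) (sym eq)) identity)))
  (λ eq → +-cancelʳ-≡ #neg _ _ (trans identity (cong (count (λ j → g j ∧ u' j) +_) eq)))
  where
  #neg : ℕ
  #neg = count (λ j → g j ∧ (signs u u' j == neg))
  identity : count (λ j → g j ∧ u j) + #neg
             ≡ count (λ j → g j ∧ u' j) + count (λ j → g j ∧ (signs u u' j == pos))
  identity = count-∧-sign g u u'

Table : Set
Table = Sign → Sign → ℕ

rowSum colSum : Table → Sign → ℕ
rowSum N a = N a pos + N a same + N a neg
colSum N b = N pos b + N same b + N neg b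

size : Table → ℕ
size N = rowSum N pos + rowSum N same + rowSum N neg

record Balanced (N : Table) : Set where
  field
    rows : rowSum N pos ≡ rowSum N neg
    cols : colSum N pos ≡ colSum N neg

_≤ᵗ_ _≗ᵗ_ : Table → Table → Set
s ≤ᵗ N = ∀ a b → s a b ≤ N a b
M ≗ᵗ N = ∀ a b → M a b ≡ N a b

sum₃-cong : ∀ {a a' b b' c c'} → a ≡ a' → b ≡ b' → c ≡ c' → a + b + c ≡ a' + b' + c'
sum₃-cong refl refl refl = refl

rowSum-cong : ∀ {M N} → M ≗ᵗ N → ∀ a → rowSum M a ≡ rowSum N a
rowSum-cong M≗N a = sum₃-cong (M≗N a pos) (M≗N a same) (M≗N a neg)

colSum-cong : ∀ {M N} → M ≗ᵗ N → ∀ b → colSum M b ≡ colSum N b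
colSum-cong M≗N b = sum₃-cong (M≗N pos b) (M≗N same b) (M≗N neg b)

size-cong : ∀ {M N} → M ≗ᵗ N → size M ≡ size N
size-cong M≗N = sum₃-cong (rowSum-cong M≗N pos) (rowSum-cong M≗N same) (rowSum-cong M≗N neg)

Balanced-resp : ∀ {M N} → M ≗ᵗ N → Balanced M → Balanced N
Balanced-resp M≗N bal = record
  { rows = trans (sym (rowSum-cong M≗N pos)) (trans (Balanced.rows bal) (rowSum-cong M≗N neg))
  ; cols = trans (sym (colSum-cong M≗N pos)) (trans (Balanced.cols bal) (colSum-cong M≗N neg))
  }

tally : ∀ {m} → (Fin m → Bool) → (Fin m → Sign) → (Fin m → Sign) → Table
tally g α β a b = count (λ j → (g j ∧ (α j == a)) ∧ (β j == b))

module _ {m : ℕ} (g : Fin m → Bool) (α β : Fin m → Sign) where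

  rowSum-tally : ∀ a → rowSum (tally g α β) a ≡ count (λ j → g j ∧ (α j == a))
  rowSum-tally a = count-by-sign (λ j → g j ∧ (α j == a)) β

  colSum-tally : ∀ b → colSum (tally g α β) b ≡ count (λ j → g j ∧ (β j == b))
  colSum-tally b = trans (sum₃-cong (swap pos) (swap same) (swap neg)) (count-by-sign (λ j → g j ∧ (β j == b)) α)
    where
    swap : ∀ a → tally g α β a b ≡ count (λ j → (g j ∧ (β j == b)) ∧ (α j == a))
    swap a = count-cong (λ j → ∧-swapʳ (g j) (α j == a) (β j == b))
      where
      ∧-swapʳ : ∀ x y z → (x ∧ y) ∧ z ≡ (x ∧ z) ∧ y
      ∧-swapʳ x y z = trans (∧-assoc x y z) (trans (cong (x ∧_) (∧-comm y z)) (sym (∧-assoc x z y)))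

  size-tally : size (tally g α β) ≡ count g
  size-tally = trans (sum₃-cong (rowSum-tally pos) (rowSum-tally same) (rowSum-tally neg)) (count-by-sign g α)

module _ {m : ℕ} (g u u' v v' : Fin m → Bool) where

  private
    N : Table
    N = tally g (signs u u') (signs v v')

  tally-balanced⇔equal-weights : Balanced N ⇔
    (count (λ j → g j ∧ u j) ≡ count (λ j → g j ∧ u' j) ×
     count (λ j → g j ∧ v j) ≡ count (λ j → g j ∧ v' j))
  tally-balanced⇔equal-weights = mk⇔
    (λ bal → from (equal-weights⇔sign-balanced g u u') (rows-as-counts (Balanced.rows bal))
           , from (equal-weights⇔sign-balanced g v v') (cols-as-counts (Balanced.cols bal)))
    (λ (eq₁ , eq₂) → record
      { rows = trans (rowSum-tally g α β pos)
                 (trans (to (equal-weights⇔sign-balanced g u u') eq₁) (sym (rowSum-tally g α β neg)))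
      ; cols = trans (colSum-tally g α β pos)
                 (trans (to (equal-weights⇔sign-balanced g v v') eq₂) (sym (colSum-tally g α β neg)))
      })
    where
    α β : Fin m → Sign
    α = signs u u'
    β = signs v v'
    open Equivalence
    rows-as-counts : rowSum N pos ≡ rowSum N neg →
      count (λ j → g j ∧ (α j == pos)) ≡ count (λ j → g j ∧ (α j == neg))
    rows-as-counts eq = trans (sym (rowSum-tally g α β pos)) (trans eq (rowSum-tally g α β neg))
    cols-as-counts : colSum N pos ≡ colSum N neg →
      count (λ j → g j ∧ (β j == pos)) ≡ count (λ j → g j ∧ (β j == neg))
    cols-as-counts eq = trans (sym (colSum-tally g α β pos)) (trans eq (colSum-tally g α β neg))

spend : Table → Sign → Sign → Table
spend B a₀ b₀ a b = if (a₀ == a) ∧ (b₀ == b) then pred (B a b) else B a b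

select : ∀ {m} → Table → (Fin m → Sign) → (Fin m → Sign) → Fin m → Bool
select B α β zero    = 0 <ᵇ B (α zero) (β zero)
select B α β (suc j) = select (spend B (α zero) (β zero)) (α ∘ suc) (β ∘ suc) j

select-count : ∀ {m} B (α β : Fin m → Sign) a b →
  count (λ j → ((α j == a) ∧ (β j == b)) ∧ select B α β j)
  ≡ B a b ⊓ count (λ j → (α j == a) ∧ (β j == b))
select-count {zero}  B α β a b = sym (⊓-zeroʳ (B a b))
select-count {suc m} B α β a b
  with (α zero == a) ∧ (β zero == b) in kind
     | select-count (spend B (α zero) (β zero)) (α ∘ suc) (β ∘ suc) a b
... | false | ih = ih
... | true  | ih = begin
  indicator (0 <ᵇ B (α zero) (β zero)) + _    ≡⟨ cong₂ (λ q c → indicator (0 <ᵇ q) + c) B₀≡B ih ⟩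
  indicator (0 <ᵇ B a b) + (pred (B a b) ⊓ _) ≡⟨ take (B a b) _ ⟩
  B a b ⊓ suc _                               ∎
  where
  open ≡-Reasoning
  B₀≡B : B (α zero) (β zero) ≡ B a b
  B₀≡B = cong₂ B (==⇒≡ _ _ (∧-conicalˡ _ _ kind)) (==⇒≡ _ _ (∧-conicalʳ _ _ kind))
  take : ∀ q c → indicator (0 <ᵇ q) + (pred q ⊓ c) ≡ q ⊓ suc c
  take zero    c = refl
  take (suc q) c = refl

tally-select : ∀ {m} {s : Table} (α β : Fin m → Sign) → s ≤ᵗ tally (λ _ → true) α β →
  tally (select s α β) α β ≗ᵗ s
tally-select {s = s} α β s≤N a b = begin
  tally (select s α β) α β a b                             ≡⟨ count-cong (λ j → rotate (select s α β j) _ _) ⟩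
  count (λ j → ((α j == a) ∧ (β j == b)) ∧ select s α β j) ≡⟨ select-count s α β a b ⟩
  s a b ⊓ tally (λ _ → true) α β a b                       ≡⟨ m≤n⇒m⊓n≡m (s≤N a b) ⟩
  s a b                                                    ∎
  where
  open ≡-Reasoning
  rotate : ∀ x y z → (x ∧ y) ∧ z ≡ (y ∧ z) ∧ x
  rotate x y z = trans (∧-assoc x y z) (∧-comm x (y ∧ z))

double-suc : ∀ a → 2 * suc a ≡ 2 + 2 * a
double-suc = solve-∀

data Parity : ℕ → Set where
  even : ∀ a → Parity (2 * a)
  odd  : ∀ a → Parity (1 + 2 * a)

parity : ∀ n → Parity n
parity zero = even 0
parity (suc n) with parity n
... | even a = odd a
... | odd a  = subst Parity (double-suc a) (even (suc a))


HalfWeight : (k S q t : ℕ) → Set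
HalfWeight k S q t = ∃[ S' ] ∃[ q' ] ∃[ t' ] S' ≤ S × q' ≤ q × t' ≤ t × S' + 4 * q' + 3 * t' ≡ 2 * k

n≤2*n : ∀ n → n ≤ 2 * n
n≤2*n n = m≤m+n n (n + 0)

n≤1+2*n : ∀ n → n ≤ 1 + 2 * n
n≤1+2*n n = m≤n⇒m≤1+n (n≤2*n n)

module _ (k : ℕ) where

  private
    choose : ∀ {S q t} S' q' t' → S' ≤ S → q' ≤ q → t' ≤ t →
      2 * (S' + 4 * q' + 3 * t') ≡ S + 4 * q + 3 * t → S + 4 * q + 3 * t ≡ 2 * (2 * k) → HalfWeight k S q t
    choose S' q' t' S'≤ q'≤ t'≤ doubled total =
      S' , q' , t' , S'≤ , q'≤ , t'≤ , *-cancelˡ-≡ _ _ 2 (trans doubled total)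

    odd-weight : ∀ {S q t} X → S + 4 * q + 3 * t ≡ 1 + 2 * X → S + 4 * q + 3 * t ≡ 2 * (2 * k) →
      HalfWeight k S q t
    odd-weight X odd-form total = contradiction (trans (sym total) odd-form) (even≢odd (2 * k) X)

  half-weight-even : ∀ c {q t} → Parity q → Parity t → 2 ≤ 2 * c →
    2 * c + 4 * q + 3 * t ≡ 2 * (2 * k) → HalfWeight k (2 * c) q t
  half-weight-even c (even a) (even b) _ = choose c a b (n≤2*n c) (n≤2*n a) (n≤2*n b) (doubled c a b)
    where doubled : ∀ c a b → 2 * (c + 4 * a + 3 * b) ≡ 2 * c + 4 * (2 * a) + 3 * (2 * b)
          doubled = solve-∀
  half-weight-even c (even a) (odd b) _ = odd-weight (c + 4 * a + 3 * b + 1) (odd-form c a b)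
    where odd-form : ∀ c a b → 2 * c + 4 * (2 * a) + 3 * (1 + 2 * b) ≡ 1 + 2 * (c + 4 * a + 3 * b + 1)
          odd-form = solve-∀
  half-weight-even c (odd a) (odd b) _ = odd-weight (c + 4 * a + 3 * b + 3) (odd-form c a b)
    where odd-form : ∀ c a b → 2 * c + 4 * (1 + 2 * a) + 3 * (1 + 2 * b) ≡ 1 + 2 * (c + 4 * a + 3 * b + 3)
          odd-form = solve-∀
  half-weight-even (suc c) (odd a) (even (suc b)) _ =
    choose c a (2 + b) (≤-trans (n≤2*n c) (*-monoʳ-≤ 2 (n≤1+n c))) (n≤1+2*n a)
      (≤-trans (+-monoʳ-≤ 2 (n≤2*n b)) (≤-reflexive (sym (double-suc b)))) (doubled c a b)
    where doubled : ∀ c a b → 2 * (c + 4 * a + 3 * (2 + b)) ≡ 2 * suc c + 4 * (1 + 2 * a) + 3 * (2 * suc b)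
          doubled = solve-∀
  -- The only case using the total modulo 4 rather than modulo 2: it forces c to be even.
  half-weight-even c (odd a) (even zero) _ with parity c
  ... | even (suc d) =
    choose (2 * d) (suc a) 0 (*-monoʳ-≤ 2 (≤-trans (n≤1+n d) (n≤2*n (suc d)))) (s≤s (n≤2*n a)) z≤n
      (doubled d a)
    where doubled : ∀ d a → 2 * (2 * d + 4 * suc a + 3 * 0) ≡ 2 * (2 * suc d) + 4 * (1 + 2 * a) + 3 * (2 * 0)
          doubled = solve-∀
  ... | odd d = λ total →
    contradiction (*-cancelˡ-≡ _ _ 2 (trans (doubled d a) total)) (≢-sym (even≢odd k (d + 2 * a + 1)))
    where doubled : ∀ d a → 2 * (1 + 2 * (d + 2 * a + 1)) ≡ 2 * (1 + 2 * d) + 4 * (1 + 2 * a) + 3 * (2 * 0)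
          doubled = solve-∀

  half-weight-odd : ∀ c {q t} → Parity q → Parity t → 2 ≤ 1 + 2 * c →
    1 + 2 * c + 4 * q + 3 * t ≡ 2 * (2 * k) → HalfWeight k (1 + 2 * c) q t
  half-weight-odd c (even a) (even b) _ = odd-weight (c + 4 * a + 3 * b) (odd-form c a b)
    where odd-form : ∀ c a b → 1 + 2 * c + 4 * (2 * a) + 3 * (2 * b) ≡ 1 + 2 * (c + 4 * a + 3 * b)
          odd-form = solve-∀
  half-weight-odd zero (even a) (odd b) (s≤s ())
  half-weight-odd (suc c) (even a) (odd b) _ =
    choose (3 + c) a b (≤-trans (+-monoʳ-≤ 3 (n≤2*n c)) (≤-reflexive (cong suc (sym (double-suc c)))))
      (n≤2*n a) (n≤1+2*n b) (doubled c a b)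
    where doubled : ∀ c a b → 2 * (3 + c + 4 * a + 3 * b) ≡ 1 + 2 * suc c + 4 * (2 * a) + 3 * (1 + 2 * b)
          doubled = solve-∀
  half-weight-odd c (odd a) (even b) _ = odd-weight (c + 4 * a + 3 * b + 2) (odd-form c a b)
    where odd-form : ∀ c a b → 1 + 2 * c + 4 * (1 + 2 * a) + 3 * (2 * b) ≡ 1 + 2 * (c + 4 * a + 3 * b + 2)
          odd-form = solve-∀
  half-weight-odd c (odd a) (odd b) _ =
    choose (suc c) a (suc b) (s≤s (n≤2*n c)) (n≤1+2*n a) (s≤s (n≤2*n b)) (doubled c a b)
    where doubled : ∀ c a b → 2 * (suc c + 4 * a + 3 * suc b) ≡ 1 + 2 * c + 4 * (1 + 2 * a) + 3 * (1 + 2 * b)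
          doubled = solve-∀

  half-weight : ∀ S q t → 2 ≤ S → S + 4 * q + 3 * t ≡ 2 * (2 * k) → HalfWeight k S q t
  half-weight S q t with parity S
  ... | even c = half-weight-even c (parity q) (parity t)
  ... | odd c  = half-weight-odd c (parity q) (parity t)

split-≤ : ∀ {t} a b → t ≤ a + b → ∃[ t₁ ] ∃[ t₂ ] t₁ ≤ a × t₂ ≤ b × t₁ + t₂ ≡ t
split-≤ {t} a b t≤a+b = a ⊓ t , t ∸ a , m⊓n≤m a t , m≤n+o⇒m∸n≤o t a t≤a+b , m⊓n+n∸m≡n a t

pairs-and-singles : ∀ {T} p z → T ≤ 2 * p + z → 1 ≤ z →
  ∃[ p' ] ∃[ z' ] p' ≤ p × z' ≤ z × 2 * p' + z' ≡ T
pairs-and-singles {T}           zero    z T≤z   _   = 0 , T , z≤n , T≤z , refl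
pairs-and-singles {zero}        (suc p) z _     _   = 0 , 0 , z≤n , z≤n , refl
pairs-and-singles {suc zero}    (suc p) z _     1≤z = 0 , 1 , z≤n , 1≤z , refl
pairs-and-singles {suc (suc T)} (suc p) z T≤ 1≤z
  with pairs-and-singles p z (≤-pred (≤-pred (≤-trans T≤ (≤-reflexive (cong (_+ z) (double-suc p)))))) 1≤z
... | p' , z' , p'≤ , z'≤ , eq =
  suc p' , z' , s≤s p'≤ , z'≤ , trans (cong (_+ z') (double-suc p')) (cong (2 +_) eq)

-- p₁, …, p₄ copies of the pairs {(+,+),(−,−)}, {(+,−),(−,+)}, {(+,0),(−,0)}, {(0,+),(0,−)},
-- q quadruples {(+,+),(+,−),(−,0),(−,0)}, t triples {(+,+),(−,0),(0,−)} and z columns (0,0).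
blocks : (p₁ p₂ p₃ p₄ q t z : ℕ) → Table
blocks p₁ p₂ p₃ p₄ q t z pos  pos  = p₁ + q + t
blocks p₁ p₂ p₃ p₄ q t z neg  neg  = p₁
blocks p₁ p₂ p₃ p₄ q t z pos  neg  = p₂ + q
blocks p₁ p₂ p₃ p₄ q t z neg  pos  = p₂
blocks p₁ p₂ p₃ p₄ q t z pos  same = p₃
blocks p₁ p₂ p₃ p₄ q t z neg  same = p₃ + 2 * q + t
blocks p₁ p₂ p₃ p₄ q t z same pos  = p₄
blocks p₁ p₂ p₃ p₄ q t z same neg  = p₄ + t
blocks p₁ p₂ p₃ p₄ q t z same same = z

blocks-balanced : ∀ p₁ p₂ p₃ p₄ q t z → Balanced (blocks p₁ p₂ p₃ p₄ q t z)
blocks-balanced p₁ p₂ p₃ p₄ q t z = record { rows = rows p₁ p₂ p₃ q t ; cols = cols p₁ p₂ p₄ q t }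
  where
  rows : ∀ p₁ p₂ p₃ q t → p₁ + q + t + p₃ + (p₂ + q) ≡ p₂ + (p₃ + 2 * q + t) + p₁
  rows = solve-∀
  cols : ∀ p₁ p₂ p₄ q t → p₁ + q + t + p₄ + p₂ ≡ p₂ + q + (p₄ + t) + p₁
  cols = solve-∀

size-blocks : ∀ p₁ p₂ p₃ p₄ q t z →
  size (blocks p₁ p₂ p₃ p₄ q t z) ≡ 2 * (p₁ + p₂ + p₃ + p₄) + z + 4 * q + 3 * t
size-blocks p₁ p₂ p₃ p₄ q t z = expand p₁ p₂ p₃ p₄ q t z
  where
  expand : ∀ p₁ p₂ p₃ p₄ q t z →
    p₁ + q + t + p₃ + (p₂ + q) + (p₄ + z + (p₄ + t)) + (p₂ + (p₃ + 2 * q + t) + p₁)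
    ≡ 2 * (p₁ + p₂ + p₃ + p₄) + z + 4 * q + 3 * t
  expand = solve-∀

blocks-mono : ∀ {p₁ p₂ p₃ p₄ q t z p₁' p₂' p₃' p₄' q' t' z'} →
  p₁' ≤ p₁ → p₂' ≤ p₂ → p₃' ≤ p₃ → p₄' ≤ p₄ → q' ≤ q → t' ≤ t → z' ≤ z →
  blocks p₁' p₂' p₃' p₄' q' t' z' ≤ᵗ blocks p₁ p₂ p₃ p₄ q t z
blocks-mono p₁ p₂ p₃ p₄ q t z pos  pos  = +-mono-≤ (+-mono-≤ p₁ q) t
blocks-mono p₁ p₂ p₃ p₄ q t z neg  neg  = p₁
blocks-mono p₁ p₂ p₃ p₄ q t z pos  neg  = +-mono-≤ p₂ q
blocks-mono p₁ p₂ p₃ p₄ q t z neg  pos  = p₂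
blocks-mono p₁ p₂ p₃ p₄ q t z pos  same = p₃
blocks-mono p₁ p₂ p₃ p₄ q t z neg  same = +-mono-≤ (+-mono-≤ p₃ (*-monoʳ-≤ 2 q)) t
blocks-mono p₁ p₂ p₃ p₄ q t z same pos  = p₄
blocks-mono p₁ p₂ p₃ p₄ q t z same neg  = +-mono-≤ p₄ t
blocks-mono p₁ p₂ p₃ p₄ q t z same same = z

module _ {N : Table} (q t : ℕ) (bal : Balanced N)
         (pp : N pos pos ≡ N neg neg + q + t) (pn : N pos neg ≡ N neg pos + q) where

  private
    shuffle : ∀ a b c → a + (b + c) ≡ b + a + c
    shuffle = solve-∀

  neg-same-entry : N neg same ≡ N pos same + 2 * q + t
  neg-same-entry = +-cancelʳ-≡ (N neg pos + N neg neg) _ _ (begin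
    N neg same + (N neg pos + N neg neg)             ≡⟨ shuffle (N neg same) (N neg pos) (N neg neg) ⟩
    rowSum N neg                                     ≡⟨ Balanced.rows bal ⟨
    N pos pos + N pos same + N pos neg               ≡⟨ cong₂ (λ a b → a + N pos same + b) pp pn ⟩
    N neg neg + q + t + N pos same + (N neg pos + q) ≡⟨ rearrange (N neg neg) (N neg pos) (N pos same) q t ⟩
    N pos same + 2 * q + t + (N neg pos + N neg neg) ∎)
    where
    open ≡-Reasoning
    rearrange : ∀ a b c q t → a + q + t + c + (b + q) ≡ c + 2 * q + t + (b + a)
    rearrange = solve-∀

  same-neg-entry : N same neg ≡ N same pos + t
  same-neg-entry = +-cancelʳ-≡ (N neg pos + q + N neg neg) _ _ (begin
    N same neg + (N neg pos + q + N neg neg)       ≡⟨ shuffle (N same neg) (N neg pos + q) (N neg neg) ⟩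
    N neg pos + q + N same neg + N neg neg         ≡⟨ cong (λ a → a + N same neg + N neg neg) pn ⟨
    colSum N neg                                   ≡⟨ Balanced.cols bal ⟨
    N pos pos + N same pos + N neg pos             ≡⟨ cong (λ a → a + N same pos + N neg pos) pp ⟩
    N neg neg + q + t + N same pos + N neg pos     ≡⟨ rearrange (N neg neg) (N neg pos) (N same pos) q t ⟩
    N same pos + t + (N neg pos + q + N neg neg)   ∎)
    where
    open ≡-Reasoning
    rearrange : ∀ a b c q t → a + q + t + c + b ≡ c + t + (b + q + a)
    rearrange = solve-∀

  balanced⇒blocks : N ≗ᵗ blocks (N neg neg) (N neg pos) (N pos same) (N same pos) q t (N same same)
  balanced⇒blocks pos  pos  = pp
  balanced⇒blocks neg  neg  = refl
  balanced⇒blocks pos  neg  = pn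
  balanced⇒blocks neg  pos  = refl
  balanced⇒blocks pos  same = refl
  balanced⇒blocks neg  same = neg-same-entry
  balanced⇒blocks same pos  = refl
  balanced⇒blocks same neg  = same-neg-entry
  balanced⇒blocks same same = refl

record BalancedHalf (k : ℕ) (N : Table) : Set where
  field
    half      : Table
    half≤     : half ≤ᵗ N
    balanced  : Balanced half
    size-half : size half ≡ 2 * k

blocks-half : ∀ k p₁ p₂ p₃ p₄ q t z → 2 ≤ z →
  size (blocks p₁ p₂ p₃ p₄ q t z) ≡ 2 * (2 * k) →
  BalancedHalf k (blocks p₁ p₂ p₃ p₄ q t z)
blocks-half k p₁ p₂ p₃ p₄ q t z 2≤z total
  with half-weight k (2 * (p₁ + p₂ + p₃ + p₄) + z) q t (≤-trans 2≤z (m≤n+m z _))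
         (trans (sym (size-blocks p₁ p₂ p₃ p₄ q t z)) total)
... | S' , q' , t' , S'≤ , q'≤ , t'≤ , weight
  with pairs-and-singles (p₁ + p₂ + p₃ + p₄) z S'≤ (≤-trans (s≤s z≤n) 2≤z)
... | p' , z' , p'≤ , z'≤ , pairs
  with split-≤ (p₁ + p₂ + p₃) p₄ p'≤
... | p₁₂₃' , p₄' , p₁₂₃'≤ , p₄'≤ , sum₄
  with split-≤ (p₁ + p₂) p₃ p₁₂₃'≤
... | p₁₂' , p₃' , p₁₂'≤ , p₃'≤ , sum₃
  with split-≤ p₁ p₂ p₁₂'≤
... | p₁' , p₂' , p₁'≤ , p₂'≤ , sum₂ = record
  { half      = blocks p₁' p₂' p₃' p₄' q' t' z'
  ; half≤     = blocks-mono p₁'≤ p₂'≤ p₃'≤ p₄'≤ q'≤ t'≤ z'≤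
  ; balanced  = blocks-balanced p₁' p₂' p₃' p₄' q' t' z'
  ; size-half = begin
      size (blocks p₁' p₂' p₃' p₄' q' t' z')              ≡⟨ size-blocks p₁' p₂' p₃' p₄' q' t' z' ⟩
      2 * (p₁' + p₂' + p₃' + p₄') + z' + 4 * q' + 3 * t' ≡⟨ cong (λ p → 2 * p + z' + 4 * q' + 3 * t') pairs-sum ⟩
      2 * p' + z' + 4 * q' + 3 * t'                      ≡⟨ cong (λ S → S + 4 * q' + 3 * t') pairs ⟩
      S' + 4 * q' + 3 * t'                               ≡⟨ weight ⟩
      2 * k                                              ∎
  }
  where
  open ≡-Reasoning
  pairs-sum : p₁' + p₂' + p₃' + p₄' ≡ p'
  pairs-sum = trans (cong (λ p → p + p₃' + p₄') sum₂) (trans (cong (_+ p₄') sum₃) sum₄)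

BalancedHalf-resp : ∀ {k M N} → M ≗ᵗ N → BalancedHalf k M → BalancedHalf k N
BalancedHalf-resp M≗N h = record
  { half      = half
  ; half≤     = λ a b → ≤-trans (half≤ a b) (≤-reflexive (M≗N a b))
  ; balanced  = balanced
  ; size-half = size-half
  }
  where open BalancedHalf h

normal-half : ∀ k N → Balanced N → size N ≡ 2 * (2 * k) → 2 ≤ N same same →
  N neg neg ≤ N pos pos → N neg pos ≤ N pos neg → N pos neg ∸ N neg pos ≤ N pos pos ∸ N neg neg →
  BalancedHalf k N
normal-half k N bal total 2≤ nn≤pp np≤pn q≤x =
  BalancedHalf-resp (λ a b → sym (N≗B a b))
    (blocks-half k (N neg neg) (N neg pos) (N pos same) (N same pos) q t (N same same) 2≤
      (trans (sym (size-cong N≗B)) total))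
  where
  x q t : ℕ
  x = N pos pos ∸ N neg neg
  q = N pos neg ∸ N neg pos
  t = x ∸ q
  pp : N pos pos ≡ N neg neg + q + t
  pp = sym (begin
    N neg neg + q + t   ≡⟨ +-assoc (N neg neg) q t ⟩
    N neg neg + (q + t) ≡⟨ cong (N neg neg +_) (m+[n∸m]≡n q≤x) ⟩
    N neg neg + x       ≡⟨ m+[n∸m]≡n nn≤pp ⟩
    N pos pos           ∎)
    where open ≡-Reasoning
  N≗B : N ≗ᵗ blocks (N neg neg) (N neg pos) (N pos same) (N same pos) q t (N same same)
  N≗B = balanced⇒blocks q t bal pp (sym (m+[n∸m]≡n np≤pn))

act : (Sign × Sign → Sign × Sign) → Table → Table
act σ N a b = uncurry N (σ (a , b))

record Symmetry : Set where
  field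
    σ                  : Sign × Sign → Sign × Sign
    involutive         : ∀ ab → σ (σ ab) ≡ ab
    size-invariant     : ∀ N → size (act σ N) ≡ size N
    balanced-invariant : ∀ {N} → Balanced N → Balanced (act σ N)

half-by-symmetry : ∀ {k N} (S : Symmetry) → BalancedHalf k (act (Symmetry.σ S) N) → BalancedHalf k N
half-by-symmetry {N = N} S h = record
  { half      = act σ half
  ; half≤     = λ a b → subst (λ ab → act σ half a b ≤ uncurry N ab) (involutive (a , b))
                              (half≤ (proj₁ (σ (a , b))) (proj₂ (σ (a , b))))
  ; balanced  = balanced-invariant balanced
  ; size-half = trans (size-invariant half) size-half
  }
  where
  open Symmetry S
  open BalancedHalf h

reverse₃ : ∀ a b c → a + b + c ≡ c + b + a
reverse₃ = solve-∀

transpose flip-second antitranspose : Symmetry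
transpose = record
  { σ                  = λ (a , b) → b , a
  ; involutive         = λ _ → refl
  ; size-invariant     = λ N → reorder (N pos pos) (N pos same) (N pos neg) (N same pos) (N same same)
                                       (N same neg) (N neg pos) (N neg same) (N neg neg)
  ; balanced-invariant = λ bal → record { rows = Balanced.cols bal ; cols = Balanced.rows bal }
  }
  where
  reorder : ∀ a b c d e f g h i →
    a + d + g + (b + e + h) + (c + f + i) ≡ a + b + c + (d + e + f) + (g + h + i)
  reorder = solve-∀
flip-second = record
  { σ                  = λ (a , b) → a , opp b
  ; involutive         = λ (a , b) → cong (a ,_) (opp-involutive b)
  ; size-invariant     = λ N → reorder (N pos pos) (N pos same) (N pos neg) (N same pos) (N same same)
                                       (N same neg) (N neg pos) (N neg same) (N neg neg)
  ; balanced-invariant = λ {N} bal → record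
      { rows = trans (reverse₃ (N pos neg) (N pos same) (N pos pos))
                 (trans (Balanced.rows bal) (reverse₃ (N neg pos) (N neg same) (N neg neg)))
      ; cols = sym (Balanced.cols bal)
      }
  }
  where
  reorder : ∀ a b c d e f g h i →
    c + b + a + (f + e + d) + (i + h + g) ≡ a + b + c + (d + e + f) + (g + h + i)
  reorder = solve-∀
antitranspose = record
  { σ                  = λ (a , b) → opp b , opp a
  ; involutive         = λ (a , b) → cong₂ _,_ (opp-involutive a) (opp-involutive b)
  ; size-invariant     = λ N → reorder (N pos pos) (N pos same) (N pos neg) (N same pos) (N same same)
                                       (N same neg) (N neg pos) (N neg same) (N neg neg)
  ; balanced-invariant = λ {N} bal → record
      { rows = trans (reverse₃ (N neg neg) (N same neg) (N pos neg))
                 (trans (sym (Balanced.cols bal)) (reverse₃ (N pos pos) (N same pos) (N neg pos)))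
      ; cols = trans (reverse₃ (N neg neg) (N neg same) (N neg pos))
                 (trans (sym (Balanced.rows bal)) (reverse₃ (N pos pos) (N pos same) (N pos neg)))
      }
  }
  where
  reorder : ∀ a b c d e f g h i →
    i + f + c + (h + e + b) + (g + d + a) ≡ a + b + c + (d + e + f) + (g + h + i)
  reorder = solve-∀

-- Transposing makes N(−,+) ≤ N(+,−), anti-transposing then makes N(−,−) ≤ N(+,+), and negating the
-- second sign swaps the differences N(+,+) ∸ N(−,−) and N(+,−) ∸ N(−,+) while keeping both inequalities.
module _ (k : ℕ) where
  open Symmetry

  half-ordered : ∀ N → Balanced N → size N ≡ 2 * (2 * k) → 2 ≤ N same same →
    N neg neg ≤ N pos pos → N neg pos ≤ N pos neg → BalancedHalf k N
  half-ordered N bal total 2≤ nn≤pp np≤pn with N pos neg ∸ N neg pos ≤? N pos pos ∸ N neg neg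
  ... | yes q≤x = normal-half k N bal total 2≤ nn≤pp np≤pn q≤x
  ... | no  q≰x = half-by-symmetry flip-second
        (normal-half k _ (balanced-invariant flip-second bal) (trans (size-invariant flip-second N) total) 2≤
          np≤pn nn≤pp (≰⇒≥ q≰x))

  half-np≤pn : ∀ N → Balanced N → size N ≡ 2 * (2 * k) → 2 ≤ N same same →
    N neg pos ≤ N pos neg → BalancedHalf k N
  half-np≤pn N bal total 2≤ np≤pn with N neg neg ≤? N pos pos
  ... | yes nn≤pp = half-ordered N bal total 2≤ nn≤pp np≤pn
  ... | no  nn≰pp = half-by-symmetry antitranspose
        (half-ordered _ (balanced-invariant antitranspose bal) (trans (size-invariant antitranspose N) total) 2≤
          (≰⇒≥ nn≰pp) np≤pn)

  balanced-half : ∀ N → Balanced N → size N ≡ 2 * (2 * k) → 2 ≤ N same same → BalancedHalf k N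
  balanced-half N bal total 2≤ with N neg pos ≤? N pos neg
  ... | yes np≤pn = half-np≤pn N bal total 2≤ np≤pn
  ... | no  np≰pn = half-by-symmetry transpose
        (half-np≤pn _ (balanced-invariant transpose bal) (trans (size-invariant transpose N) total) 2≤
          (≰⇒≥ np≰pn))

agree⇒same : ∀ {b b' d d'} → b ≡ b' → d ≡ d' → (sign b b' == same) ∧ (sign d d' == same) ≡ true
agree⇒same {true}  {d = true}  refl refl = refl
agree⇒same {true}  {d = false} refl refl = refl
agree⇒same {false} {d = true}  refl refl = refl
agree⇒same {false} {d = false} refl refl = refl

record BalancingColumns {m : ℕ} (k : ℕ) (u u' v v' : Fin m → Bool) : Set where
  field
    chosen       : Fin m → Bool
    count-chosen : count chosen ≡ 2 * k
    balances-u   : count (λ j → chosen j ∧ u j) ≡ count (λ j → chosen j ∧ u' j)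
    balances-v   : count (λ j → chosen j ∧ v j) ≡ count (λ j → chosen j ∧ v' j)

balancing-columns : ∀ {m} k (u u' v v' : Fin m → Bool) → m ≡ 2 * (2 * k) →
  count u ≡ count u' → count v ≡ count v' →
  ∀ {c c'} → c ≢ c' → u c ≡ u' c → v c ≡ v' c → u c' ≡ u' c' → v c' ≡ v' c' →
  BalancingColumns k u u' v v'
balancing-columns {m} k u u' v v' m≡4k u≈u' v≈v' c≢c' uc vc uc' vc' = record
  { chosen       = x
  ; count-chosen = trans (sym (size-tally x α β)) (trans (size-cong x-tally) size-half)
  ; balances-u   = proj₁ balances
  ; balances-v   = proj₂ balances
  }
  where
  open Equivalence
  α β : Fin m → Sign
  α = signs u u'
  β = signs v v'
  open BalancedHalf (balanced-half k (tally (λ _ → true) α β)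
    (from (tally-balanced⇔equal-weights _ u u' v v') (u≈u' , v≈v'))
    (trans (size-tally _ α β) (trans (count-true m) m≡4k))
    (2≤count _ c≢c' (agree⇒same uc vc) (agree⇒same uc' vc')))
  x : Fin m → Bool
  x = select half α β
  x-tally : tally x α β ≗ᵗ half
  x-tally = tally-select α β half≤
  balances : count (λ j → x j ∧ u j) ≡ count (λ j → x j ∧ u' j) ×
             count (λ j → x j ∧ v j) ≡ count (λ j → x j ∧ v' j)
  balances = to (tally-balanced⇔equal-weights x u u' v v')
                (Balanced-resp (λ a b → sym (x-tally a b)) balanced)

joint : ∀ {m} → (Fin m → Bool) → (Fin m → Bool) → Bool → Bool → ℕ
joint x y a b = count (λ j → if eqB (x j) a then eqB (y j) b else false)

module _ {m : ℕ} (x y : Fin m → Bool) where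

  joint-not : ∀ a b → joint (not ∘ x) y a b ≡ joint x y (not a) b
  joint-not a b = count-cong (λ j → flip (x j) a (eqB (y j) b))
    where
    flip : ∀ c a t → (if eqB (not c) a then t else false) ≡ (if eqB c (not a) then t else false)
    flip true  true  t = refl
    flip true  false t = refl
    flip false true  t = refl
    flip false false t = refl

  joint-true-true : joint x y true true ≡ count (λ j → x j ∧ y j)
  joint-true-true = count-cong (λ j → tt (x j) (y j))
    where
    tt : ∀ c d → (if eqB c true then eqB d true else false) ≡ c ∧ d
    tt true  true  = refl
    tt true  false = refl
    tt false _     = refl

  joint-marginalˡ : ∀ a → joint x y a true + joint x y a false ≡ occ a x
  joint-marginalˡ a = count-+ _ _ _ (λ j → split (eqB (x j) a) (y j))
    where
    split : ∀ t d → indicator (if t then eqB d true else false) + indicator (if t then eqB d false else false)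
                    ≡ indicator t
    split false _     = refl
    split true  true  = refl
    split true  false = refl

  joint-marginalʳ : ∀ b → joint x y true b + joint x y false b ≡ occ b y
  joint-marginalʳ b = count-+ _ _ _ (λ j → split (x j) (eqB (y j) b))
    where
    split : ∀ c t → indicator (if eqB c true then t else false) + indicator (if eqB c false then t else false)
                    ≡ indicator t
    split true  true  = refl
    split true  false = refl
    split false true  = refl
    split false false = refl

complementRows : ∀ {m} → (Fin m → Bool) → Array 2 m
complementRows x zero    j = x j
complementRows x (suc _) j = not (x j)

complementRows-isBFR : ∀ {m h} (e : m ≡ 2 * h) (x : Fin m → Bool) → (∀ b → occ b x ≡ h) →
  IsBFR m h e (complementRows x)
complementRows-isBFR e x x-occ = rows , cols
  where
  rows : ∀ i → occ false (complementRows x i) ≡ _ × occ true (complementRows x i) ≡ _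
  rows zero    = x-occ false , x-occ true
  rows (suc zero) = trans (occ-not x false) (x-occ true) , trans (occ-not x true) (x-occ false)
  cols : ∀ j → occ false (λ i → complementRows x i j) ≡ 1 × occ true (λ i → complementRows x i j) ≡ 1
  cols j with x j
  ... | true  = refl , refl
  ... | false = refl , refl

complementRows-orthogonal : ∀ {m h} (x : Fin m → Bool) (G : Array 2 m) →
  (∀ b → occ b (G zero) ≡ h) → (∀ b → occ b (G (suc zero)) ≡ h) →
  count (λ j → x j ∧ G zero j) ≡ count (λ j → x j ∧ G (suc zero) j) →
  Orthogonal (complementRows x) G
complementRows-orthogonal {h = h} x G u-occ v-occ balanced a b a' b' =
  trans (pairCount≡h a b) (sym (pairCount≡h a' b'))
  where
  open ≡-Reasoning
  u v : Fin _ → Bool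
  u = G zero
  v = G (suc zero)
  agree-on-x : ∀ b → joint x u true b ≡ joint x v true b
  agree-on-x true  = trans (joint-true-true x u) (trans balanced (sym (joint-true-true x v)))
  agree-on-x false = +-cancelˡ-≡ (joint x u true true) _ _ (begin
    joint x u true true + joint x u true false ≡⟨ joint-marginalˡ x u true ⟩
    occ true x                                 ≡⟨ joint-marginalˡ x v true ⟨
    joint x v true true + joint x v true false ≡⟨ cong (_+ joint x v true false) (agree-on-x true) ⟨
    joint x u true true + joint x v true false ∎)
  pairCount≡h : ∀ a b → pairCount (complementRows x) G a b ≡ h
  pairCount≡h true b = begin
    joint x u true b + (joint (not ∘ x) v true b + 0)
      ≡⟨ cong₂ _+_ (agree-on-x b) (trans (+-identityʳ _) (joint-not x v true b)) ⟩
    joint x v true b + joint x v false b              ≡⟨ joint-marginalʳ x v b ⟩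
    occ b v                                           ≡⟨ v-occ b ⟩
    h                                                 ∎
  pairCount≡h false b = begin
    joint x u false b + (joint (not ∘ x) v false b + 0)
      ≡⟨ cong (joint x u false b +_) (trans (+-identityʳ _) (joint-not x v false b)) ⟩
    joint x u false b + joint x v true b                ≡⟨ cong (joint x u false b +_) (agree-on-x b) ⟨
    joint x u false b + joint x u true b                ≡⟨ +-comm (joint x u false b) _ ⟩
    joint x u true b + joint x u false b                ≡⟨ joint-marginalʳ x u b ⟩
    occ b u                                             ≡⟨ u-occ b ⟩
    h                                                   ∎

corollary5p11 : (n k : ℕ) → 8 ≤ n → (e : n ≡ 2 * (2 * k)) →
    (F1 F2 : Array n n) → IsBFS n (2 * k) e F1 → IsBFS n (2 * k) e F2 →
    (r r' : Fin n) → r ≢ r' →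
    (c c' : Fin n) → c ≢ c' →
    F1 r c ≡ F1 r' c → F2 r c ≡ F2 r' c →
    F1 r c' ≡ F1 r' c' → F2 r c' ≡ F2 r' c' →
    Balanceable n (2 * k) e F1 F2 r r'
corollary5p11 n k _ e F1 F2 (rows₁ , _) (rows₂ , _) r r' _ c c' c≢c' F1c F2c F1c' F2c' =
  complementRows chosen ,
  complementRows-isBFR e chosen (count≡half⇒occ chosen e count-chosen) ,
  complementRows-orthogonal chosen (rowsOf F1 r r')
    (occ-both (F1 r) (rows₁ r)) (occ-both (F1 r') (rows₁ r')) balances-u ,
  complementRows-orthogonal chosen (rowsOf F2 r r')
    (occ-both (F2 r) (rows₂ r)) (occ-both (F2 r') (rows₂ r')) balances-v
  where
  open BalancingColumns (balancing-columns k (F1 r) (F1 r') (F2 r) (F2 r') e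
    (equal-row-weights F1 rows₁ r r') (equal-row-weights F2 rows₂ r r') c≢c' F1c F2c F1c' F2c')
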